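{- Let $a\neq b$ be positive integers and consider the $a$-$b$ chip-firing game started with $n$ chips at vertex $0$. For any state $\sigma$ reachable from the initial state, the numbers $f_0(\sigma)$ and $f_1(\sigma)$ of firings of vertex $0$ and of vertex $1$ are the same for every finite sequence of legal firings leading from the initial state to $\sigma$.
   Context: The $a$-$b$ chip-firing game on $\mathbb{Z}$: a vertex $i$ with at least $a+b$ chips may fire, losing $a+b$ chips while vertex $i-1$ gains $a$ and vertex $i+1$ gains $b$. -}

module Defs where

open import Data.Nat using (ℕ; zero; suc)
open import Data.Integer using (ℤ; +_; _+_; _-_; _≤_)
open import Data.List using (List; []; _∷_)
open import Relation.Binary.PropositionalEquality using (_≡_)
open import Relation.Nullary using (does)
import Data.Integer as ℤ
open import Data.Bool using (if_then_else_)
open import Relation.Nullary using (Dec)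

Config : Set
Config = ℤ → ℤ

initial : ℕ → Config
initial n i = if does (i ℤ.≟ + 0) then + n else + 0

-- Firing vertex v in the a-b game: v loses a+b, v-1 gains a, v+1 gains b.
-- (The three updates are applied additively, as vertices are distinct.)
fire : ℕ → ℕ → ℤ → Config → Config
fire a b v σ i =
  σ i + (upd (i ℤ.≟ v) (ℤ.- (+ a + + b)) + (upd (i ℤ.≟ (v - + 1)) (+ a) + upd (i ℤ.≟ (v + + 1)) (+ b)))
  where
  upd : {P : Set} → Dec P → ℤ → ℤ
  upd d z = if does d then z else + 0

data LegalRun (a b : ℕ) : Config → List ℤ → Config → Set where
  done : ∀ {σ} → LegalRun a b σ [] σ
  step : ∀ {σ v vs τ} → (+ a + + b) ≤ σ v →
         LegalRun a b (fire a b v σ) vs τ → LegalRun a b σ (v ∷ vs) τ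

count : ℤ → List ℤ → ℕ
count v [] = zero
count v (w ∷ ws) = if does (v ℤ.≟ w) then suc (count v ws) else count v ws

_≗c_ : Config → Config → Set
σ ≗c τ = ∀ i → σ i ≡ τ i

-- Firing w adds a fixed vector to the configuration, so a run in which each
-- vertex j fires c j times ends in σ₀ + Δc, where Δc = netFlow a b c:
-- (Δc) i = b·c(i−1) − (a+b)·c i + a·c(i+1).  Two runs reaching the same state
-- thus satisfy Δc = Δc'.  As b ≠ 0, (Δc) i determines c(i−1) from c i and
-- c(i+1); since c and c' both vanish far to the right, descending induction
-- gives c = c' on ℕ.
module Submission where

open import Defs
open import Data.Nat using (ℕ; NonZero)
open import Data.Integer using (ℤ; +_)
open import Data.List using (List)
open import Data.Product using (_×_)
open import Relation.Binary.PropositionalEquality using (_≡_; _≢_)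

open import Data.Bool using (true; false; if_then_else_)
open import Data.Empty using (⊥-elim)
open import Data.Integer using (_+_; _-_; _*_; -_; ∣_∣; _≟_)
import Data.Integer.Properties as ℤ
open import Data.Integer.Tactic.RingSolver using (solve-∀)
open import Data.List using ([]; _∷_; map)
open import Data.Nat using (zero; suc; _≤_) renaming (_+_ to _+ℕ_)
open import Data.Nat.ListAction using (sum)
import Data.Nat.Properties as ℕ
open import Data.Product using (_,_)
open import Function using (_∘_)
open import Function.Bundles using (_⇔_; mk⇔)
open import Relation.Binary.PropositionalEquality
  using (refl; sym; trans; cong; cong₂; subst; module ≡-Reasoning)
open import Relation.Nullary using (does; yes; no)
open import Relation.Nullary.Decidable using (does-⇔)
open import Algebra.Properties.AbelianGroup ℤ.+-0-abelianGroup
  using (∙-cancelˡ; //-rightDividesˡ; //-rightDividesʳ)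

i≡j-k⇔i+k≡j : ∀ i j k → i ≡ j - k ⇔ i + k ≡ j
i≡j-k⇔i+k≡j i j k = mk⇔
  (λ i≡j-k → trans (cong (_+ k) i≡j-k) (//-rightDividesˡ k j))
  (λ i+k≡j → trans (sym (//-rightDividesʳ k i)) (cong (_- k) i+k≡j))

i≡j+k⇔i-k≡j : ∀ i j k → i ≡ j + k ⇔ i - k ≡ j
i≡j+k⇔i-k≡j i j k = mk⇔
  (λ i≡j+k → trans (cong (_- k) i≡j+k) (//-rightDividesʳ k j))
  (λ i-k≡j → trans (sym (//-rightDividesˡ k i)) (cong (_+ k) i-k≡j))

indicator : ℤ → ℤ → ℤ
indicator w i = if does (i ≟ w) then + 1 else + 0

firings : List ℤ → ℤ → ℤ
firings vs v = + count v vs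

firings-∷ : ∀ w ws i → firings (w ∷ ws) i ≡ indicator w i + firings ws i
firings-∷ w ws i with does (i ≟ w)
... | true  = refl
... | false = sym (ℤ.+-identityˡ (firings ws i))

netFlow : ℕ → ℕ → (ℤ → ℤ) → ℤ → ℤ
netFlow a b c i = - (+ a + + b) * c i + (+ a * c (i + + 1) + + b * c (i - + 1))

netFlow-cong : ∀ a b {c c'} → (∀ j → c j ≡ c' j) → ∀ i → netFlow a b c i ≡ netFlow a b c' i
netFlow-cong a b c≗c' i =
  cong₂ _+_ (cong (- (+ a + + b) *_) (c≗c' i))
            (cong₂ _+_ (cong (+ a *_) (c≗c' (i + + 1))) (cong (+ b *_) (c≗c' (i - + 1))))

netFlow-zero : ∀ a b i → netFlow a b (λ _ → + 0) i ≡ + 0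
netFlow-zero a b i = lemma (+ a) (+ b)
  where
  lemma : ∀ A B → - (A + B) * + 0 + (A * + 0 + B * + 0) ≡ + 0
  lemma = solve-∀

netFlow-+ : ∀ a b c c' i → netFlow a b (λ j → c j + c' j) i ≡ netFlow a b c i + netFlow a b c' i
netFlow-+ a b c c' i = lemma (+ a) (+ b) (c i) (c (i + + 1)) (c (i - + 1)) (c' i) (c' (i + + 1)) (c' (i - + 1))
  where
  lemma : ∀ A B x y z x' y' z' →
    - (A + B) * (x + x') + (A * (y + y') + B * (z + z'))
      ≡ (- (A + B) * x + (A * y + B * z)) + (- (A + B) * x' + (A * y' + B * z'))
  lemma = solve-∀

if-scale : ∀ t z → (if t then z else + 0) ≡ z * (if t then + 1 else + 0)
if-scale true  z = sym (ℤ.*-identityʳ z)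
if-scale false z = sym (ℤ.*-zeroʳ z)

fire-netFlow : ∀ a b w σ i → fire a b w σ i ≡ σ i + netFlow a b (indicator w) i
fire-netFlow a b w σ i =
  cong (_+_ (σ i)) (cong₂ _+_ (if-scale (does (i ≟ w)) _) (cong₂ _+_ gainFromRight gainFromLeft))
  where
  gainFromRight : (if does (i ≟ w - + 1) then + a else + 0) ≡ + a * indicator w (i + + 1)
  gainFromRight = trans
    (cong (λ t → if t then + a else + 0) (does-⇔ (i≡j-k⇔i+k≡j i w (+ 1)) (i ≟ w - + 1) (i + + 1 ≟ w)))
    (if-scale _ (+ a))
  gainFromLeft : (if does (i ≟ w + + 1) then + b else + 0) ≡ + b * indicator w (i - + 1)
  gainFromLeft = trans
    (cong (λ t → if t then + b else + 0) (does-⇔ (i≡j+k⇔i-k≡j i w (+ 1)) (i ≟ w + + 1) (i - + 1 ≟ w)))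
    (if-scale _ (+ b))

LegalRun-netFlow : ∀ {a b σ vs τ} → LegalRun a b σ vs τ → ∀ i → τ i ≡ σ i + netFlow a b (firings vs) i
LegalRun-netFlow {a} {b} {σ} done i = sym (trans (cong (_+_ (σ i)) (netFlow-zero a b i)) (ℤ.+-identityʳ (σ i)))
LegalRun-netFlow {a} {b} {σ} (step {v = v} {vs = vs} _ run) i = begin
  _                                                                  ≡⟨ LegalRun-netFlow run i ⟩
  fire a b v σ i + netFlow a b (firings vs) i                        ≡⟨ cong (_+ netFlow a b (firings vs) i) (fire-netFlow a b v σ i) ⟩
  σ i + netFlow a b (indicator v) i + netFlow a b (firings vs) i     ≡⟨ ℤ.+-assoc (σ i) _ _ ⟩
  σ i + (netFlow a b (indicator v) i + netFlow a b (firings vs) i)   ≡⟨ cong (_+_ (σ i)) (sym (netFlow-+ a b (indicator v) (firings vs) i)) ⟩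
  σ i + netFlow a b (λ j → indicator v j + firings vs j) i           ≡⟨ cong (_+_ (σ i)) (sym (netFlow-cong a b (firings-∷ v vs) i)) ⟩
  σ i + netFlow a b (firings (v ∷ vs)) i                             ∎
  where open ≡-Reasoning

netFlow-determines-pred : ∀ a b .{{_ : NonZero b}} {c c'} i → netFlow a b c i ≡ netFlow a b c' i →
  c i ≡ c' i → c (i + + 1) ≡ c' (i + + 1) → c (i - + 1) ≡ c' (i - + 1)
netFlow-determines-pred a b {c} {c'} i sameFlow here right =
  ℤ.*-cancelˡ-≡ (+ b) _ _ (∙-cancelˡ (+ a * c' (i + + 1)) _ _ (∙-cancelˡ (- (+ a + + b) * c' i) _ _ shifted))
  where
  shifted : - (+ a + + b) * c' i + (+ a * c' (i + + 1) + + b * c (i - + 1)) ≡ netFlow a b c' i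
  shifted = trans
    (cong₂ (λ x y → - (+ a + + b) * x + (+ a * y + + b * c (i - + 1))) (sym here) (sym right))
    sameFlow

netFlow-injective : ∀ a b .{{_ : NonZero b}} {c c'} → (∀ i → netFlow a b c i ≡ netFlow a b c' i) →
  ∀ N → (∀ k → N ≤ k → c (+ k) ≡ c' (+ k)) → ∀ k → c (+ k) ≡ c' (+ k)
netFlow-injective a b {c} {c'} sameFlow N beyondN k = descend N k (ℕ.m≤m+n N k)
  where
  descend : ∀ m k → N ≤ m +ℕ k → c (+ k) ≡ c' (+ k)
  descend zero    k N≤k = beyondN k N≤k
  descend (suc m) k N≤1+m+k = netFlow-determines-pred a b {c} {c'} (+ suc k) (sameFlow (+ suc k))
    (descend m (suc k) N≤m+1+k)
    (subst (λ i → c i ≡ c' i) (cong (λ j → + suc j) (ℕ.+-comm 1 k))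
      (descend m (suc (suc k)) (ℕ.≤-trans N≤m+1+k (ℕ.+-monoʳ-≤ m (ℕ.n≤1+n (suc k))))))
    where
    N≤m+1+k : N ≤ m +ℕ suc k
    N≤m+1+k = subst (N ≤_) (sym (ℕ.+-suc m k)) N≤1+m+k

supportBound : List ℤ → ℕ
supportBound vs = sum (map (suc ∘ ∣_∣) vs)

count-beyond-supportBound : ∀ vs k → supportBound vs ≤ k → count (+ k) vs ≡ 0
count-beyond-supportBound []       k _  = refl
count-beyond-supportBound (w ∷ ws) k bound≤k with + k ≟ w
... | yes k≡w = ⊥-elim (ℕ.<-irrefl (cong ∣_∣ (sym k≡w)) (ℕ.≤-trans (ℕ.m≤m+n (suc ∣ w ∣) _) bound≤k))
... | no  _   = count-beyond-supportBound ws k (ℕ.≤-trans (ℕ.m≤n+m _ (suc ∣ w ∣)) bound≤k)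

mainTheorem6 : (a b n : ℕ) → NonZero a → NonZero b → a ≢ b →
    (σ : Config) (vs ws : List ℤ) (τ : Config) →
    LegalRun a b (initial n) vs σ → LegalRun a b (initial n) ws τ → σ ≗c τ →
    (count (+ 0) vs ≡ count (+ 0) ws) × (count (+ 1) vs ≡ count (+ 1) ws)
mainTheorem6 a b n _ b≢0 _ σ vs ws τ run₁ run₂ σ≗τ = sameCount 0 , sameCount 1
  where
  sameFlow : ∀ i → netFlow a b (firings vs) i ≡ netFlow a b (firings ws) i
  sameFlow i = ∙-cancelˡ (initial n i) _ _
    (trans (sym (LegalRun-netFlow run₁ i)) (trans (σ≗τ i) (LegalRun-netFlow run₂ i)))

  N : ℕ
  N = supportBound vs +ℕ supportBound ws

  bothZeroBeyondN : ∀ k → N ≤ k → firings vs (+ k) ≡ firings ws (+ k)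
  bothZeroBeyondN k N≤k = cong +_ (trans
    (count-beyond-supportBound vs k (ℕ.≤-trans (ℕ.m≤m+n _ _) N≤k))
    (sym (count-beyond-supportBound ws k (ℕ.≤-trans (ℕ.m≤n+m _ _) N≤k))))

  sameCount : ∀ k → count (+ k) vs ≡ count (+ k) ws
  sameCount k = ℤ.+-injective (netFlow-injective a b {{b≢0}} sameFlow N bothZeroBeyondN k)
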